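{- Let $u=(u_1,\dots,u_d)$ be a non-sink vertex of $\square_n^d$ with $1\le u_i\le\lceil n/2\rceil$ for all $1\le i\le d$. Then for every non-sink vertex $v$ of $\square_n^d$, \[ \pi_u(v)\ge\Big(\frac{1}{2d}\Big)^d\pi_u((n,n,\dots,n)). \]
   Context: The graph $\square_n^d$ has vertex set $\{1,\dots,n\}^d\cup\{s\}$, where $s$ is a sink. Non-sink vertices differing by $1$ in exactly one coordinate are adjacent. Boundary vertices have extra (possibly parallel) edges to $s$ so that every non-sink vertex has degree $2d$. For non-sink vertices $u,v$, the potential $\pi_u(v)$ is the probability that the simple random walk on $\square_n^d$ started at $v$ hits $u$ before hitting $s$. Each step of this walk traverses a uniformly random one of the $2d$ incident edges. -}

module Defs where

open import Data.Nat as ℕ using (ℕ; zero; suc)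
open import Data.Fin as Fin using (Fin; zero; suc; inject₁)
open import Data.Fin.Properties using () renaming (_≟_ to _≟ᶠ_)
open import Data.Vec using (Vec; lookup; updateAt; allFin)
open import Data.Vec.Properties using (≡-dec)
open import Data.Maybe using (Maybe; just; nothing; maybe)
open import Data.Bool using (Bool; true; false)
open import Data.List using (List; []; _∷_; foldr; map; concatMap)
open import Data.Vec using (toList)
open import Data.Integer using (+_)
open import Data.Rational using (ℚ; 0ℚ; 1ℚ; _+_; _*_; _/_)
open import Relation.Nullary using (yes; no)

-- A non-sink vertex of the grid graph □ₙᵈ: coordinate i of the paper's
-- vertex (a value in {1,…,n}) is represented by an element of Fin n,
-- i.e. the value (toℕ xᵢ + 1).
Vertex : ℕ → ℕ → Set
Vertex d n = Vec (Fin n) d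

-- moving one step up / down in a single coordinate; nothing = leaving the
-- box, i.e. the edge goes to the sink s
up : ∀ {n} → Fin n → Maybe (Fin n)
up {suc zero} zero = nothing
up {suc (suc k)} zero = just (suc zero)
up (suc x) = Data.Maybe.map suc (up x)

down : ∀ {n} → Fin n → Maybe (Fin n)
down zero = nothing
down (suc x) = just (inject₁ x)

-- The endpoint of the edge at v in coordinate i and direction b
-- (true = +1, false = -1); nothing means the edge leads to the sink s.
-- Every non-sink vertex thus has exactly 2d incident edges, indexed by (i , b).
step : ∀ {d n} → Vertex d n → Fin d → Bool → Maybe (Vertex d n)
step v i true  = Data.Maybe.map (λ y → updateAt v i (λ _ → y)) (up (lookup v i))
step v i false = Data.Maybe.map (λ y → updateAt v i (λ _ → y)) (down (lookup v i))

sumℚ : List ℚ → ℚ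
sumℚ = foldr _+_ 0ℚ

-- 1/k as a rational (with the junk value 0 for k = 0)
inv : ℕ → ℚ
inv zero = 0ℚ
inv (suc k) = (+ 1) / suc k

_^ℚ_ : ℚ → ℕ → ℚ
q ^ℚ zero = 1ℚ
q ^ℚ suc k = q * (q ^ℚ k)

-- hitProb u k v : probability that the simple random walk on □ₙᵈ started
-- at v hits u within at most k steps, before hitting the sink s.
-- (Each step uses a uniformly random one of the 2d incident edges; the walk
-- is killed at s.)
hitProb : ∀ {d n} → Vertex d n → ℕ → Vertex d n → ℚ
hitProb {d} {n} u k v with ≡-dec _≟ᶠ_ v u
... | yes _ = 1ℚ
hitProb {d} {n} u zero v | no _ = 0ℚ
hitProb {d} {n} u (suc k) v | no _ =
  inv (2 ℕ.* d) *
  sumℚ (concatMap (λ i → map (λ b → maybe (hitProb u k) 0ℚ (step v i b))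
                             (true ∷ false ∷ []))
                  (toList (allFin d)))

-- The potential π_u(v) = P_v(hit u before s) is the supremum (limit) of the
-- nondecreasing sequence hitProb u k v.  We express inequalities between
-- such suprema without reals:
--   c · sup_k a_k ≤ sup_m b_m   ⇔   ∀ k, ∀ ε > 0, ∃ m, c · a_k ≤ b_m + ε.

-- Write h_k(v) for the probability of hitting u within k steps.  Two comparisons do all the work.
--
-- Reflection: let c be a level with u_i ≤ c and m ≤ 2c (coordinates run over 0,…,m).  If a vertex x
-- lies beyond the hyperplane x_i = c and y is its mirror image, then h_k(x) ≤ h_k(y).  Couple the
-- walks by mirroring every move in direction i until they meet on the hyperplane: since m ≤ 2c the
-- mirrored walk leaves the box only if the walk from x does, and the walk from x cannot reach u
-- (which lies on the near side) without meeting the other one first.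
--
-- Raising one coordinate: let w′ be w with w_i replaced by the top value m.  If w_i + m is even,
-- w′ is the mirror image of w; if it is odd, w′ is the mirror image of the upper neighbour of w in
-- direction i, to which the walk moves with probability 1/(2d).  The mirror level c then satisfies
-- m ≤ 2c, and the hypothesis on u says 2u_i ≤ m, so u is on the near side.  Either way
-- (1/2d)·h_k(w′) ≤ h_{k+1}(w), and raising the d coordinates of v one after the other gives
-- (1/2d)^d·h_k(m,…,m) ≤ h_{k+d}(v).

module Submission where

open import Defs
open import Data.Nat as ℕ using (ℕ; zero; suc; z≤n; s≤s)
import Data.Nat.Properties as ℕP
import Data.Nat.Coprimality as Coprime
open import Data.Fin using (Fin; zero; suc; toℕ; fromℕ)
import Data.Fin.Properties as FinP
open import Data.Vec using (Vec; []; _∷_; lookup; replicate; tabulate; allFin; toList; _[_]≔_)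
open import Data.Vec.Properties
  using (≡-dec; lookup∘update; lookup∘update′; []≔-idempotent; []≔-commutes; []≔-lookup;
         tabulate∘lookup; tabulate-cong; lookup-replicate)
open import Data.Vec.Membership.Propositional using (_∈_)
open import Data.Vec.Membership.Propositional.Properties using (∈-allFin⁺)
open import Data.Vec.Relation.Unary.Any using (here; there)
import Data.List as List
open import Data.Maybe as Maybe using (Maybe; just; nothing; maybe)
open import Data.Maybe.Properties using (maybe-map; map-cong; map-∘)
open import Data.Bool using (Bool; true; false)
open import Data.Integer as ℤ using (+_)
import Data.Integer.Properties as ℤP
import Data.Sign.Base as Sign
open import Data.Rational using (ℚ; 0ℚ; 1ℚ; _<_; _≤_; _+_; _*_; mkℚ; NonNegative; nonNegative; *≤*)
import Data.Rational.Properties as ℚP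
open import Data.Product using (Σ; ∃-syntax; _,_; _×_)
open import Data.Sum using (_⊎_; inj₁; inj₂)
open import Function using (_∘_)
open import Relation.Nullary using (Dec; yes; no; contradiction)
open import Relation.Binary.PropositionalEquality
  using (_≡_; _≢_; refl; sym; trans; cong; cong₂; subst; module ≡-Reasoning)

data UpView {n} (x : Fin n) : Maybe (Fin n) → Set where
  at-top : suc (toℕ x) ≡ n → UpView x nothing
  up-to  : ∀ {y} → toℕ y ≡ suc (toℕ x) → UpView x (just y)

upView : ∀ {n} (x : Fin n) → UpView x (up x)
upView {suc zero}    zero    = at-top refl
upView {suc (suc n)} zero    = up-to refl
upView {suc (suc n)} (suc x) with up x | upView x
... | nothing | at-top e = at-top (cong suc e)
... | just _  | up-to e  = up-to (cong suc e)

data DownView {n} (x : Fin n) : Maybe (Fin n) → Set where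
  at-bottom : toℕ x ≡ 0 → DownView x nothing
  down-to   : ∀ {y} → suc (toℕ y) ≡ toℕ x → DownView x (just y)

downView : ∀ {n} (x : Fin n) → DownView x (down x)
downView zero    = at-bottom refl
downView (suc x) = down-to (cong suc (FinP.toℕ-inject₁ x))

move : ∀ {n} → Bool → Fin n → Maybe (Fin n)
move true  = up
move false = down

step≡move : ∀ {d n} (v : Vertex d n) i t →
            step v i t ≡ Maybe.map (v [ i ]≔_) (move t (lookup v i))
step≡move v i true  = refl
step≡move v i false = refl

step-along : ∀ {d n} (w : Vertex d n) i a t →
             step (w [ i ]≔ a) i t ≡ Maybe.map (w [ i ]≔_) (move t a)
step-along w i a t = begin
  step (w [ i ]≔ a) i t
    ≡⟨ step≡move (w [ i ]≔ a) i t ⟩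
  Maybe.map (w [ i ]≔ a [ i ]≔_) (move t (lookup (w [ i ]≔ a) i))
    ≡⟨ cong (Maybe.map (w [ i ]≔ a [ i ]≔_) ∘ move t) (lookup∘update i w a) ⟩
  Maybe.map (w [ i ]≔ a [ i ]≔_) (move t a)
    ≡⟨ map-cong (λ _ → []≔-idempotent w i) (move t a) ⟩
  Maybe.map (w [ i ]≔_) (move t a)
    ∎
  where open ≡-Reasoning

step-across : ∀ {d n} (w : Vertex d n) {i j} a t → j ≢ i →
              step (w [ i ]≔ a) j t ≡ Maybe.map (_[ i ]≔ a) (step w j t)
step-across w {i} {j} a t j≢i = begin
  step (w [ i ]≔ a) j t
    ≡⟨ step≡move (w [ i ]≔ a) j t ⟩
  Maybe.map (w [ i ]≔ a [ j ]≔_) (move t (lookup (w [ i ]≔ a) j))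
    ≡⟨ cong (Maybe.map (w [ i ]≔ a [ j ]≔_) ∘ move t) (lookup∘update′ j≢i w a) ⟩
  Maybe.map (w [ i ]≔ a [ j ]≔_) (move t (lookup w j))
    ≡⟨ map-cong (λ _ → []≔-commutes w i j (j≢i ∘ sym)) (move t (lookup w j)) ⟩
  Maybe.map (λ y → w [ j ]≔ y [ i ]≔ a) (move t (lookup w j))
    ≡⟨ map-∘ (move t (lookup w j)) ⟩
  Maybe.map (_[ i ]≔ a) (Maybe.map (w [ j ]≔_) (move t (lookup w j)))
    ≡⟨ cong (Maybe.map (_[ i ]≔ a)) (step≡move w j t) ⟨
  Maybe.map (_[ i ]≔ a) (step w j t)
    ∎
  where open ≡-Reasoning

setAll : ∀ {A : Set} {d l} → Vec (Fin d) l → A → Vec A d → Vec A d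
setAll []       x w = w
setAll (i ∷ is) x w = setAll is x (w [ i ]≔ x)

lookup-setAll-preserved : ∀ {A : Set} {d l} (is : Vec (Fin d) l) x (w : Vec A d) {j} →
                          lookup w j ≡ x → lookup (setAll is x w) j ≡ x
lookup-setAll-preserved []       x w wj≡x = wj≡x
lookup-setAll-preserved (i ∷ is) x w {j} wj≡x =
  lookup-setAll-preserved is x (w [ i ]≔ x) updated
  where
  updated : lookup (w [ i ]≔ x) j ≡ x
  updated with j FinP.≟ i
  ... | yes refl = lookup∘update i w x
  ... | no j≢i   = trans (lookup∘update′ j≢i w x) wj≡x

lookup-setAll : ∀ {A : Set} {d l} (is : Vec (Fin d) l) x (w : Vec A d) {j} →
                j ∈ is → lookup (setAll is x w) j ≡ x
lookup-setAll (i ∷ is) x w (here refl)  =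
  lookup-setAll-preserved is x (w [ i ]≔ x) (lookup∘update i w x)
lookup-setAll (i ∷ is) x w (there j∈is) = lookup-setAll is x (w [ i ]≔ x) j∈is

setAll-allFin : ∀ {A : Set} {d} (x : A) (w : Vec A d) → setAll (allFin d) x w ≡ replicate d x
setAll-allFin {d = d} x w = begin
  setAll (allFin d) x w                ≡⟨ tabulate∘lookup _ ⟨
  tabulate (lookup (setAll (allFin d) x w)) ≡⟨ tabulate-cong lookup-agrees ⟩
  tabulate (lookup (replicate d x))    ≡⟨ tabulate∘lookup _ ⟩
  replicate d x                        ∎
  where
  open ≡-Reasoning
  lookup-agrees : ∀ j → lookup (setAll (allFin d) x w) j ≡ lookup (replicate d x) j
  lookup-agrees j = trans (lookup-setAll (allFin d) x w (∈-allFin⁺ j)) (sym (lookup-replicate j x))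

-- Built with mkℚ rather than as + n / 1 so that its numerator and denominator compute.
ofℕ : ℕ → ℚ
ofℕ n = mkℚ (+ n) 0 (Coprime.sym (Coprime.1-coprimeTo n))

1+ofℕ : ∀ n → 1ℚ + ofℕ n ≡ ofℕ (suc n)
1+ofℕ n = trans (ℚP./-cong {q₁ = 1} {q₂ = 1} numerator refl) (ℚP.↥p/↧p≡p (ofℕ (suc n)))
  where
  numerator : + 1 ℤ.+ (Sign.+ ℤ.◃ (n ℕ.* 1)) ≡ + suc n
  numerator rewrite ℕP.*-identityʳ n | ℤP.+◃n≡+n n = refl

inv-suc : ∀ n → inv (suc n) ≡ mkℚ (+ 1) n (Coprime.1-coprimeTo (suc n))
inv-suc n = ℚP.↥p/↧p≡p (mkℚ (+ 1) n (Coprime.1-coprimeTo (suc n)))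

inv-nonNeg : ∀ n → NonNegative (inv n)
inv-nonNeg zero    = _
inv-nonNeg (suc n) = ℚP.normalize-nonNeg 1 (suc n)

inv≤1 : ∀ n → inv n ≤ 1ℚ
inv≤1 zero    = ℚP.≤ᵇ⇒≤ _
inv≤1 (suc n) rewrite inv-suc n = *≤* (ℤ.+≤+ (s≤s z≤n))

inv*ofℕ : ∀ n → inv (suc n) * ofℕ (suc n) ≡ 1ℚ
inv*ofℕ n rewrite inv-suc n = ℚP.*-inverseˡ (ofℕ (suc n))

inv-*-monoʳ-≤ : ∀ n {p q} → p ≤ q → inv n * p ≤ inv n * q
inv-*-monoʳ-≤ n = ℚP.*-monoˡ-≤-nonNeg (inv n) {{inv-nonNeg n}}

inv-*-≤ : ∀ n {q} → 0ℚ ≤ q → inv n * q ≤ q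
inv-*-≤ n {q} 0≤q = subst (inv n * q ≤_) (ℚP.*-identityˡ q)
  (ℚP.*-monoʳ-≤-nonNeg q {{nonNegative 0≤q}} (inv≤1 n))

inv-*-nonNeg : ∀ n {q} → 0ℚ ≤ q → 0ℚ ≤ inv n * q
inv-*-nonNeg n {q} 0≤q = subst (_≤ inv n * q) (ℚP.*-zeroʳ (inv n)) (inv-*-monoʳ-≤ n 0≤q)

inv-*-≤1 : ∀ n {q} → q ≤ ofℕ n → inv n * q ≤ 1ℚ
inv-*-≤1 zero    {q} _   = subst (_≤ 1ℚ) (sym (ℚP.*-zeroˡ q)) (ℚP.≤ᵇ⇒≤ _)
inv-*-≤1 (suc n) {q} q≤n = subst (inv (suc n) * q ≤_) (inv*ofℕ n) (inv-*-monoʳ-≤ (suc n) q≤n)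

p≤p+q : ∀ {p q} → 0ℚ ≤ q → p ≤ p + q
p≤p+q {p} {q} 0≤q = subst (_≤ p + q) (ℚP.+-identityʳ p) (ℚP.+-monoʳ-≤ p 0≤q)

q≤p+q : ∀ {p q} → 0ℚ ≤ p → q ≤ p + q
q≤p+q {p} {q} 0≤p = subst (_≤ p + q) (ℚP.+-identityˡ q) (ℚP.+-monoˡ-≤ q 0≤p)

edgeSum : ∀ {d l} → (Fin d → Bool → ℚ) → Vec (Fin d) l → ℚ
edgeSum f is =
  sumℚ (List.concatMap (λ i → List.map (f i) (true List.∷ false List.∷ List.[])) (toList is))

pairSum : ∀ {d} → (Fin d → Bool → ℚ) → Fin d → ℚ
pairSum f i = f i true + f i false

edgeSum-∷ : ∀ {d l} (f : Fin d → Bool → ℚ) i (is : Vec (Fin d) l) →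
            edgeSum f (i ∷ is) ≡ pairSum f i + edgeSum f is
edgeSum-∷ f i is = sym (ℚP.+-assoc (f i true) (f i false) (edgeSum f is))

edgeSum-mono : ∀ {d l} (f g : Fin d → Bool → ℚ) → (∀ i → pairSum f i ≤ pairSum g i) →
               (is : Vec (Fin d) l) → edgeSum f is ≤ edgeSum g is
edgeSum-mono f g f≤g [] = ℚP.≤-refl
edgeSum-mono f g f≤g (i ∷ is) = begin
  edgeSum f (i ∷ is)            ≡⟨ edgeSum-∷ f i is ⟩
  pairSum f i + edgeSum f is    ≤⟨ ℚP.+-mono-≤ (f≤g i) (edgeSum-mono f g f≤g is) ⟩
  pairSum g i + edgeSum g is    ≡⟨ edgeSum-∷ g i is ⟨
  edgeSum g (i ∷ is)            ∎
  where open ℚP.≤-Reasoning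

edgeSum-nonNeg : ∀ {d l} (f : Fin d → Bool → ℚ) → (∀ i t → 0ℚ ≤ f i t) →
                 (is : Vec (Fin d) l) → 0ℚ ≤ edgeSum f is
edgeSum-nonNeg f f≥0 []       = ℚP.≤-refl
edgeSum-nonNeg f f≥0 (i ∷ is) =
  ℚP.+-mono-≤ (f≥0 i true) (ℚP.+-mono-≤ (f≥0 i false) (edgeSum-nonNeg f f≥0 is))

edgeSum-≤ : ∀ {d l} (f : Fin d → Bool → ℚ) → (∀ i t → f i t ≤ 1ℚ) →
            (is : Vec (Fin d) l) → edgeSum f is ≤ ofℕ (2 ℕ.* l)
edgeSum-≤ f f≤1 [] = ℚP.≤-refl
edgeSum-≤ {l = suc l} f f≤1 (i ∷ is) = begin
  edgeSum f (i ∷ is)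
    ≤⟨ ℚP.+-mono-≤ (f≤1 i true) (ℚP.+-mono-≤ (f≤1 i false) (edgeSum-≤ f f≤1 is)) ⟩
  1ℚ + (1ℚ + ofℕ (2 ℕ.* l))   ≡⟨ cong (λ q → 1ℚ + q) (1+ofℕ (2 ℕ.* l)) ⟩
  1ℚ + ofℕ (1 ℕ.+ 2 ℕ.* l)    ≡⟨ 1+ofℕ (1 ℕ.+ 2 ℕ.* l) ⟩
  ofℕ (2 ℕ.+ 2 ℕ.* l)         ≡⟨ cong ofℕ (ℕP.*-suc 2 l) ⟨
  ofℕ (2 ℕ.* suc l)           ∎
  where open ℚP.≤-Reasoning

term≤pairSum : ∀ {d} (f : Fin d → Bool → ℚ) → (∀ i t → 0ℚ ≤ f i t) →
               ∀ i t → f i t ≤ pairSum f i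
term≤pairSum f f≥0 i true  = p≤p+q (f≥0 i false)
term≤pairSum f f≥0 i false = q≤p+q (f≥0 i true)

pairSum≤edgeSum : ∀ {d l} (f : Fin d → Bool → ℚ) → (∀ i t → 0ℚ ≤ f i t) →
                  {i : Fin d} {is : Vec (Fin d) l} → i ∈ is → pairSum f i ≤ edgeSum f is
pairSum≤edgeSum f f≥0 {is = i ∷ is} (here refl) =
  subst (pairSum f i ≤_) (sym (edgeSum-∷ f i is)) (p≤p+q (edgeSum-nonNeg f f≥0 is))
pairSum≤edgeSum f f≥0 {i} {j ∷ is} (there i∈is) = begin
  pairSum f i                   ≤⟨ pairSum≤edgeSum f f≥0 i∈is ⟩
  edgeSum f is                  ≤⟨ q≤p+q (ℚP.+-mono-≤ (f≥0 j true) (f≥0 j false)) ⟩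
  pairSum f j + edgeSum f is    ≡⟨ edgeSum-∷ f j is ⟨
  edgeSum f (j ∷ is)            ∎
  where open ℚP.≤-Reasoning

maybe-preserves : ∀ {A : Set} (P : ℚ → Set) {f : A → ℚ} {z} → P z → (∀ a → P (f a)) →
                  ∀ o → P (maybe f z o)
maybe-preserves P pz pf nothing  = pz
maybe-preserves P pz pf (just a) = pf a

maybe-mono : ∀ {A : Set} {f g : A → ℚ} → (∀ a → f a ≤ g a) →
             ∀ o → maybe f 0ℚ o ≤ maybe g 0ℚ o
maybe-mono f≤g nothing  = ℚP.≤-refl
maybe-mono f≤g (just a) = f≤g a

-- Hitting probabilities

neighbourProb : ∀ {d n} → Vertex d n → ℕ → Vertex d n → Fin d → Bool → ℚ
neighbourProb u k v i t = maybe (hitProb u k) 0ℚ (step v i t)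

neighbourProb-along : ∀ {d n} (u : Vertex d n) k w i a t →
                      neighbourProb u k (w [ i ]≔ a) i t ≡
                      maybe (hitProb u k ∘ (w [ i ]≔_)) 0ℚ (move t a)
neighbourProb-along u k w i a t =
  trans (cong (maybe (hitProb u k) 0ℚ) (step-along w i a t))
        (maybe-map (hitProb u k) 0ℚ (w [ i ]≔_) (move t a))

neighbourProb-across : ∀ {d n} (u : Vertex d n) k w {i j} a t → j ≢ i →
                       neighbourProb u k (w [ i ]≔ a) j t ≡
                       maybe (hitProb u k ∘ (_[ i ]≔ a)) 0ℚ (step w j t)
neighbourProb-across u k w {i} {j} a t j≢i =
  trans (cong (maybe (hitProb u k) 0ℚ) (step-across w a t j≢i))
        (maybe-map (hitProb u k) 0ℚ (_[ i ]≔ a) (step w j t))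

module _ {d n} (u : Vertex d n) where

  private
    ι : ℚ
    ι = inv (2 ℕ.* d)

  hitProb-target : ∀ k → hitProb u k u ≡ 1ℚ
  hitProb-target k with ≡-dec FinP._≟_ u u
  ... | yes _   = refl
  ... | no u≢u = contradiction refl u≢u

  hitProb-zero : ∀ {v} → v ≢ u → hitProb u 0 v ≡ 0ℚ
  hitProb-zero {v} v≢u with ≡-dec FinP._≟_ v u
  ... | yes v≡u = contradiction v≡u v≢u
  ... | no _    = refl

  hitProb-suc : ∀ {v} k → v ≢ u →
                hitProb u (suc k) v ≡ ι * edgeSum (neighbourProb u k v) (allFin d)
  hitProb-suc {v} k v≢u with ≡-dec FinP._≟_ v u
  ... | yes v≡u = contradiction v≡u v≢u
  ... | no _    = refl

  hitProb-nonNeg : ∀ k v → 0ℚ ≤ hitProb u k v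
  neighbourProb-nonNeg : ∀ k v i t → 0ℚ ≤ neighbourProb u k v i t

  hitProb-nonNeg k v with ≡-dec FinP._≟_ v u
  ... | yes _ = ℚP.≤ᵇ⇒≤ _
  hitProb-nonNeg zero    v | no _ = ℚP.≤-refl
  hitProb-nonNeg (suc k) v | no _ =
    inv-*-nonNeg (2 ℕ.* d) (edgeSum-nonNeg _ (neighbourProb-nonNeg k v) (allFin d))

  neighbourProb-nonNeg k v i t = maybe-preserves (0ℚ ≤_) ℚP.≤-refl (hitProb-nonNeg k) (step v i t)

  hitProb-≤1 : ∀ k v → hitProb u k v ≤ 1ℚ
  neighbourProb-≤1 : ∀ k v i t → neighbourProb u k v i t ≤ 1ℚ

  hitProb-≤1 k v with ≡-dec FinP._≟_ v u
  ... | yes _ = ℚP.≤-refl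
  hitProb-≤1 zero    v | no _ = ℚP.≤ᵇ⇒≤ _
  hitProb-≤1 (suc k) v | no _ =
    inv-*-≤1 (2 ℕ.* d) (edgeSum-≤ _ (neighbourProb-≤1 k v) (allFin d))

  neighbourProb-≤1 k v i t = maybe-preserves (_≤ 1ℚ) (ℚP.≤ᵇ⇒≤ _) (hitProb-≤1 k) (step v i t)

  hitProb-≤-target : ∀ k v → hitProb u k v ≤ hitProb u k u
  hitProb-≤-target k v = subst (hitProb u k v ≤_) (sym (hitProb-target k)) (hitProb-≤1 k v)

  hitProb-mono : ∀ k v → hitProb u k v ≤ hitProb u (suc k) v
  hitProb-mono k v with ≡-dec FinP._≟_ v u
  ... | yes _ = ℚP.≤-refl
  hitProb-mono zero    v | no _ =
    inv-*-nonNeg (2 ℕ.* d) (edgeSum-nonNeg _ (neighbourProb-nonNeg 0 v) (allFin d))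
  hitProb-mono (suc k) v | no _ =
    inv-*-monoʳ-≤ (2 ℕ.* d) (edgeSum-mono (neighbourProb u k v) (neighbourProb u (suc k) v) pair-mono (allFin d))
    where
    pair-mono : ∀ i → pairSum (neighbourProb u k v) i ≤ pairSum (neighbourProb u (suc k) v) i
    pair-mono i = ℚP.+-mono-≤ (maybe-mono (hitProb-mono k) (step v i true))
                               (maybe-mono (hitProb-mono k) (step v i false))

  hitProb-neighbour : ∀ k v i t → ι * neighbourProb u k v i t ≤ hitProb u (suc k) v
  hitProb-neighbour k v i t with ≡-dec FinP._≟_ v u
  ... | yes _ = ℚP.≤-trans (inv-*-≤ (2 ℕ.* d) (neighbourProb-nonNeg k v i t)) (neighbourProb-≤1 k v i t)
  ... | no _  = inv-*-monoʳ-≤ (2 ℕ.* d) (ℚP.≤-trans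
                  (term≤pairSum (neighbourProb u k v) (neighbourProb-nonNeg k v) i t)
                  (pairSum≤edgeSum (neighbourProb u k v) (neighbourProb-nonNeg k v) (∈-allFin⁺ i)))

  hitProb-suc-mono : ∀ k {x y} → x ≢ u → y ≢ u →
                     (∀ i → pairSum (neighbourProb u k x) i ≤ pairSum (neighbourProb u k y) i) →
                     hitProb u (suc k) x ≤ hitProb u (suc k) y
  hitProb-suc-mono k {x} {y} x≢u y≢u pairs = begin
    hitProb u (suc k) x
      ≡⟨ hitProb-suc k x≢u ⟩
    ι * edgeSum (neighbourProb u k x) (allFin d)
      ≤⟨ inv-*-monoʳ-≤ (2 ℕ.* d)
           (edgeSum-mono (neighbourProb u k x) (neighbourProb u k y) pairs (allFin d)) ⟩
    ι * edgeSum (neighbourProb u k y) (allFin d)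
      ≡⟨ hitProb-suc k y≢u ⟨
    hitProb u (suc k) y
      ∎
    where open ℚP.≤-Reasoning

⌊n/2⌋≤ : ∀ {n c} → n ℕ.≤ c ℕ.+ c → ℕ.⌊ n /2⌋ ℕ.≤ c
⌊n/2⌋≤ {c = c} n≤2c =
  subst (ℕ.⌊ _ /2⌋ ℕ.≤_) (sym (ℕP.n≡⌊n+n/2⌋ c)) (ℕP.⌊n/2⌋-mono n≤2c)

half-≤ : ∀ {a b} → a ℕ.+ a ℕ.≤ b ℕ.+ b → a ℕ.≤ b
half-≤ {a} 2a≤2b = subst (ℕ._≤ _) (sym (ℕP.n≡⌊n+n/2⌋ a)) (⌊n/2⌋≤ 2a≤2b)

even-or-odd : ∀ n → ∃[ c ] (n ≡ c ℕ.+ c ⊎ n ≡ suc (c ℕ.+ c))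
even-or-odd zero = 0 , inj₁ refl
even-or-odd (suc n) with even-or-odd n
... | c , inj₁ n≡2c   = c , inj₂ (cong suc n≡2c)
... | c , inj₂ n≡2c+1 = suc c , inj₁ (trans (cong suc n≡2c+1) (sym (ℕP.+-suc (suc c) c)))

m+m≢1+n+n : ∀ m n → m ℕ.+ m ≢ suc (n ℕ.+ n)
m+m≢1+n+n m n eq = ℕP.even≢odd m n (begin
  m ℕ.+ (m ℕ.+ 0)       ≡⟨ cong (m ℕ.+_) (ℕP.+-identityʳ m) ⟩
  m ℕ.+ m               ≡⟨ eq ⟩
  suc (n ℕ.+ n)         ≡⟨ cong (λ x → suc (n ℕ.+ x)) (ℕP.+-identityʳ n) ⟨
  suc (n ℕ.+ (n ℕ.+ 0)) ∎)
  where open ≡-Reasoning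

+-shift : ∀ {x x′ y y′} → x′ ≡ suc x → suc y′ ≡ y → x′ ℕ.+ y′ ≡ x ℕ.+ y
+-shift {x} {y′ = y′} refl refl = sym (ℕP.+-suc x y′)

odd-step : ∀ {x x′ m c} → x′ ≡ suc x → x ℕ.+ m ≡ suc (c ℕ.+ c) →
           m ℕ.+ x′ ≡ suc c ℕ.+ suc c
odd-step {x} {m = m} {c} refl x+m≡2c+1 = begin
  m ℕ.+ suc x          ≡⟨ ℕP.+-suc m x ⟩
  suc (m ℕ.+ x)        ≡⟨ cong suc (ℕP.+-comm m x) ⟩
  suc (x ℕ.+ m)        ≡⟨ cong suc x+m≡2c+1 ⟩
  suc (suc (c ℕ.+ c))  ≡⟨ cong suc (ℕP.+-suc c c) ⟨
  suc c ℕ.+ suc c      ∎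
  where open ≡-Reasoning

-- Reflection in the hyperplane xᵢ = c

module Reflection {d m} (u : Vertex d (suc m)) (i : Fin d) (c : ℕ)
                  (u-near : toℕ (lookup u i) ℕ.≤ c) (c-centred : m ℕ.≤ c ℕ.+ c) where

  Mirrored : Fin (suc m) → Fin (suc m) → Set
  Mirrored a b = toℕ a ℕ.+ toℕ b ≡ c ℕ.+ c × c ℕ.≤ toℕ a

  Reflects : ℕ → Set
  Reflects k = ∀ w {a b} → Mirrored a b → hitProb u k (w [ i ]≔ a) ≤ hitProb u k (w [ i ]≔ b)

  ReflectsStrictly : ℕ → Set
  ReflectsStrictly k = ∀ w {a b} → Mirrored a b → c ℕ.< toℕ a → w [ i ]≔ b ≢ u →
                       hitProb u k (w [ i ]≔ a) ≤ hitProb u k (w [ i ]≔ b)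

  mirrored-centre : ∀ {a b} → Mirrored a b → c ≡ toℕ a → a ≡ b
  mirrored-centre {a} {b} (a+b≡2c , _) refl =
    FinP.toℕ-injective (sym (ℕP.+-cancelˡ-≡ (toℕ a) (toℕ b) (toℕ a) a+b≡2c))

  mirrored-near : ∀ {a b} → Mirrored a b → c ℕ.< toℕ a → toℕ b ℕ.< c
  mirrored-near (a+b≡2c , _) c<a =
    ℕP.≰⇒> (λ c≤b → ℕP.<-irrefl (sym a+b≡2c) (ℕP.+-mono-<-≤ c<a c≤b))

  far≢u : ∀ w {a} → c ℕ.< toℕ a → w [ i ]≔ a ≢ u
  far≢u w {a} c<a w[i]≔a≡u = ℕP.<⇒≱ c<a (subst (ℕ._≤ c) a-on-axis u-near)
    where
    a-on-axis : toℕ (lookup u i) ≡ toℕ a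
    a-on-axis = cong toℕ (trans (cong (λ v → lookup v i) (sym w[i]≔a≡u)) (lookup∘update i w a))

  module _ {k} (reflects : Reflects k) (w : Vertex d (suc m)) where

    private
      F : Maybe (Fin (suc m)) → ℚ
      F = maybe (hitProb u k ∘ (w [ i ]≔_)) 0ℚ

      F-nonNeg : ∀ o → 0ℚ ≤ F o
      F-nonNeg = maybe-preserves (0ℚ ≤_) ℚP.≤-refl (λ a → hitProb-nonNeg u k (w [ i ]≔ a))

    up-vs-down : ∀ {a b} → Mirrored a b → F (up a) ≤ F (down b)
    up-vs-down {a} {b} (a+b≡2c , c≤a) with up a | upView a
    ... | nothing | _ = F-nonNeg (down b)
    ... | just a′ | up-to a′≡1+a with down b | downView b
    ...   | nothing | at-bottom b≡0 = contradiction m≤a (ℕP.<⇒≱ a<m)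
      where
      a<m : toℕ a ℕ.< m
      a<m = subst (ℕ._≤ m) a′≡1+a (FinP.toℕ≤pred[n] a′)
      m≤a : m ℕ.≤ toℕ a
      m≤a = ℕP.≤-trans c-centred (ℕP.≤-reflexive (begin
        c ℕ.+ c           ≡⟨ a+b≡2c ⟨
        toℕ a ℕ.+ toℕ b   ≡⟨ cong (toℕ a ℕ.+_) b≡0 ⟩
        toℕ a ℕ.+ 0       ≡⟨ ℕP.+-identityʳ (toℕ a) ⟩
        toℕ a             ∎))
        where open ≡-Reasoning
    ...   | just b′ | down-to 1+b′≡b =
      reflects w (trans (+-shift a′≡1+a 1+b′≡b) a+b≡2c ,
                  subst (c ℕ.≤_) (sym a′≡1+a) (ℕP.m≤n⇒m≤1+n c≤a))

    down-vs-up : ∀ {a b} → Mirrored a b → c ℕ.< toℕ a → F (down a) ≤ F (up b)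
    down-vs-up {a} {b} mir@(a+b≡2c , c≤a) c<a with down a | downView a
    ... | nothing | _ = F-nonNeg (up b)
    ... | just a′ | down-to 1+a′≡a with up b | upView b
    ...   | nothing | at-top 1+b≡1+m = contradiction (ℕP.suc-injective 1+b≡1+m) (ℕP.<⇒≢ b<m)
      where
      b<m : toℕ b ℕ.< m
      b<m = ℕP.<-≤-trans (mirrored-near mir c<a) (ℕP.≤-trans c≤a (FinP.toℕ≤pred[n] a))
    ...   | just b′ | up-to b′≡1+b =
      reflects w (trans (sym (+-shift (sym 1+a′≡a) (sym b′≡1+b))) a+b≡2c ,
                  ℕP.≤-pred (subst (suc c ℕ.≤_) (sym 1+a′≡a) c<a))

    pairSum-along : ∀ {a b} → Mirrored a b → c ℕ.< toℕ a →
                    pairSum (neighbourProb u k (w [ i ]≔ a)) i ≤ pairSum (neighbourProb u k (w [ i ]≔ b)) i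
    pairSum-along {a} {b} mir c<a = begin
      pairSum (neighbourProb u k (w [ i ]≔ a)) i
        ≡⟨ cong₂ _+_ (neighbourProb-along u k w i a true) (neighbourProb-along u k w i a false) ⟩
      F (up a) + F (down a)   ≤⟨ ℚP.+-mono-≤ (up-vs-down mir) (down-vs-up mir c<a) ⟩
      F (down b) + F (up b)   ≡⟨ ℚP.+-comm (F (down b)) (F (up b)) ⟩
      F (up b) + F (down b)
        ≡⟨ cong₂ _+_ (neighbourProb-along u k w i b true) (neighbourProb-along u k w i b false) ⟨
      pairSum (neighbourProb u k (w [ i ]≔ b)) i ∎
      where open ℚP.≤-Reasoning

    pairSum-across : ∀ {a b} → Mirrored a b → ∀ {j} → j ≢ i →
                     pairSum (neighbourProb u k (w [ i ]≔ a)) j ≤ pairSum (neighbourProb u k (w [ i ]≔ b)) j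
    pairSum-across {a} {b} mir {j} j≢i = ℚP.+-mono-≤ (across true) (across false)
      where
      open ℚP.≤-Reasoning
      across : ∀ t → neighbourProb u k (w [ i ]≔ a) j t ≤ neighbourProb u k (w [ i ]≔ b) j t
      across t = begin
        neighbourProb u k (w [ i ]≔ a) j t
          ≡⟨ neighbourProb-across u k w a t j≢i ⟩
        maybe (hitProb u k ∘ (_[ i ]≔ a)) 0ℚ (step w j t)
          ≤⟨ maybe-mono (λ v → reflects v mir) (step w j t) ⟩
        maybe (hitProb u k ∘ (_[ i ]≔ b)) 0ℚ (step w j t)
          ≡⟨ neighbourProb-across u k w b t j≢i ⟨
        neighbourProb u k (w [ i ]≔ b) j t
          ∎

  reflection-step : ∀ {k} → Reflects k → ReflectsStrictly (suc k)
  reflection-step {k} reflects w mir c<a near≢u = hitProb-suc-mono u k (far≢u w c<a) near≢u pairs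
    where
    pairs : ∀ j → pairSum (neighbourProb u k (w [ i ]≔ _)) j ≤ pairSum (neighbourProb u k (w [ i ]≔ _)) j
    pairs j with j FinP.≟ i
    ... | yes refl = pairSum-along reflects w mir c<a
    ... | no j≢i   = pairSum-across reflects w mir j≢i

  reflects-from-strict : ∀ {k} → ReflectsStrictly k → Reflects k
  reflects-from-strict {k} strict w {a} {b} mir@(_ , c≤a) with ℕP.m≤n⇒m<n∨m≡n c≤a
  ... | inj₂ c≡a = ℚP.≤-reflexive (cong (λ z → hitProb u k (w [ i ]≔ z)) (mirrored-centre mir c≡a))
  ... | inj₁ c<a = by-near (≡-dec FinP._≟_ (w [ i ]≔ b) u)
    where
    by-near : Dec (w [ i ]≔ b ≡ u) → hitProb u k (w [ i ]≔ a) ≤ hitProb u k (w [ i ]≔ b)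
    by-near (no near≢u)  = strict w mir c<a near≢u
    by-near (yes near≡u) = subst (λ v → hitProb u k (w [ i ]≔ a) ≤ hitProb u k v) (sym near≡u)
                             (hitProb-≤-target u k (w [ i ]≔ a))

  reflection : ∀ k → Reflects k
  reflection zero = reflects-from-strict λ w {a} {b} mir c<a _ →
    subst (_≤ hitProb u 0 (w [ i ]≔ b)) (sym (hitProb-zero u (far≢u w c<a)))
          (hitProb-nonNeg u 0 (w [ i ]≔ b))
  reflection (suc k) = reflects-from-strict (reflection-step (reflection k))

module Corner {d m} (u : Vertex d (suc m)) (u-central : ∀ i → toℕ (lookup u i) ℕ.≤ ℕ.⌊ m /2⌋) where

  top : Fin (suc m)
  top = fromℕ m

  ι : ℚ
  ι = inv (2 ℕ.* d)

  reflect-top : ∀ k w i {b} c → m ℕ.+ toℕ b ≡ c ℕ.+ c →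
                hitProb u k (w [ i ]≔ top) ≤ hitProb u k (w [ i ]≔ b)
  reflect-top k w i {b} c m+b≡2c =
    Reflection.reflection u i c (ℕP.≤-trans (u-central i) (⌊n/2⌋≤ m≤2c)) m≤2c k w (top+b≡2c , c≤top)
    where
    m≤2c : m ℕ.≤ c ℕ.+ c
    m≤2c = subst (m ℕ.≤_) m+b≡2c (ℕP.m≤m+n m (toℕ b))
    top+b≡2c : toℕ top ℕ.+ toℕ b ≡ c ℕ.+ c
    top+b≡2c = trans (cong (ℕ._+ toℕ b) (FinP.toℕ-fromℕ m)) m+b≡2c
    c≤top : c ℕ.≤ toℕ top
    c≤top = subst (c ℕ.≤_) (sym (FinP.toℕ-fromℕ m))
              (half-≤ (subst (ℕ._≤ m ℕ.+ m) m+b≡2c (ℕP.+-monoʳ-≤ m (FinP.toℕ≤pred[n] b))))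

  raise-coordinate : ∀ k w i → ι * hitProb u k (w [ i ]≔ top) ≤ hitProb u (suc k) w
  raise-coordinate k w i with even-or-odd (toℕ (lookup w i) ℕ.+ m)
  ... | c , inj₁ a+m≡2c = begin
    ι * hitProb u k (w [ i ]≔ top)       ≤⟨ inv-*-≤ (2 ℕ.* d) (hitProb-nonNeg u k (w [ i ]≔ top)) ⟩
    hitProb u k (w [ i ]≔ top)           ≤⟨ reflect-top k w i c (trans (ℕP.+-comm m _) a+m≡2c) ⟩
    hitProb u k (w [ i ]≔ lookup w i)    ≡⟨ cong (hitProb u k) ([]≔-lookup w i) ⟩
    hitProb u k w                        ≤⟨ hitProb-mono u k w ⟩
    hitProb u (suc k) w                  ∎
    where open ℚP.≤-Reasoning
  ... | c , inj₂ a+m≡2c+1 = begin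
    ι * hitProb u k (w [ i ]≔ top)       ≤⟨ inv-*-monoʳ-≤ (2 ℕ.* d) top≤up-neighbour ⟩
    ι * neighbourProb u k w i true       ≤⟨ hitProb-neighbour u k w i true ⟩
    hitProb u (suc k) w                  ∎
    where
    open ℚP.≤-Reasoning
    top≤up-neighbour : hitProb u k (w [ i ]≔ top) ≤ neighbourProb u k w i true
    top≤up-neighbour with up (lookup w i) | upView (lookup w i)
    ... | nothing | at-top 1+a≡1+m =
      contradiction (trans (cong (ℕ._+ m) (sym (ℕP.suc-injective 1+a≡1+m))) a+m≡2c+1) (m+m≢1+n+n m c)
    ... | just a′ | up-to a′≡1+a = reflect-top k w i (suc c) (odd-step a′≡1+a a+m≡2c+1)

  raise-coordinates : ∀ {l} (is : Vec (Fin d) l) w k →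
                      ι ^ℚ l * hitProb u k (setAll is top w) ≤ hitProb u (l ℕ.+ k) w
  raise-coordinates []       w k = ℚP.≤-reflexive (ℚP.*-identityˡ (hitProb u k w))
  raise-coordinates {suc l} (i ∷ is) w k = begin
    ι * ι ^ℚ l * hitProb u k (setAll is top (w [ i ]≔ top))   ≡⟨ ℚP.*-assoc ι (ι ^ℚ l) _ ⟩
    ι * (ι ^ℚ l * hitProb u k (setAll is top (w [ i ]≔ top)))
      ≤⟨ inv-*-monoʳ-≤ (2 ℕ.* d) (raise-coordinates is (w [ i ]≔ top) k) ⟩
    ι * hitProb u (l ℕ.+ k) (w [ i ]≔ top)                    ≤⟨ raise-coordinate (l ℕ.+ k) w i ⟩
    hitProb u (suc l ℕ.+ k) w                                 ∎
    where open ℚP.≤-Reasoning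

  corner-bound : ∀ v k → ι ^ℚ d * hitProb u k (replicate d top) ≤ hitProb u (d ℕ.+ k) v
  corner-bound v k = subst (λ corner → ι ^ℚ d * hitProb u k corner ≤ hitProb u (d ℕ.+ k) v)
                           (setAll-allFin top v) (raise-coordinates (allFin d) v k)

mainTheorem13 : (d m : ℕ) → 1 ℕ.≤ d →
    (u : Vertex d (suc m)) →
    ((i : Fin d) → suc (toℕ (lookup u i)) ℕ.≤ ℕ.⌈ suc m /2⌉) →
    (v : Vertex d (suc m)) →
    (k : ℕ) → (ε : ℚ) → 0ℚ < ε →
    Σ ℕ (λ j → (inv (2 ℕ.* d) ^ℚ d) * hitProb u k (replicate d (fromℕ m))
                 ≤ hitProb u j v + ε)
-- The bound also holds for d = 0.
mainTheorem13 d m _ u u-central v k ε ε>0 =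
  d ℕ.+ k , ℚP.≤-trans (corner-bound v k) (p≤p+q (ℚP.<⇒≤ ε>0))
  where open Corner u (λ i → ℕP.≤-pred (u-central i))
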